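{- $Tr(5,B)=8$, where $B$ is the butterfly poset.
   Context: The butterfly poset $B$ has four elements $a,b,c,d$ with $a<c$, $a<d$, $b<c$, $b<d$ and no other relations. The sets $F_1,\dots,F_{|P|}$ form a copy of a poset $P$ if there is a bijection $i:P\to\{F_1,\dots,F_{|P|}\}$ such that $p<_P p'$ implies $i(p)\subsetneq i(p')$; a family is $P$-free if it contains no copy of $P$. For $X$ a set and $\mathcal F$ a family, $\mathcal F|_X=\{F\cap X:F\in\mathcal F\}$. A family $\mathcal F\subseteq 2^{[n]}$ is trace $P$-free if $\mathcal F|_L$ is $P$-free for every $L\subseteq[n]$, and $Tr(n,P)$ is the maximum size of a trace $P$-free family in $2^{[n]}$. -}

module Defs where

open import Data.Nat using (ℕ)
open import Data.Fin.Subset using (Subset; _⊂_; _∩_)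
open import Data.List using (List)
open import Data.List.Membership.Propositional using (_∈_)
open import Data.Product using (Σ; ∃; _×_)
open import Relation.Binary.PropositionalEquality using (_≡_; _≢_)
open import Relation.Nullary using (¬_)

-- A family of subsets of [n] given as a membership predicate
-- (used for traces, which are sets, so duplicates are irrelevant).
Family : ℕ → Set₁
Family n = Subset n → Set

-- The family contains a (not necessarily induced) copy of the butterfly
-- poset B: four distinct members a, b, c, d with a ⊊ c, a ⊊ d, b ⊊ c, b ⊊ d.
-- (a ≢ c, a ≢ d, b ≢ c, b ≢ d follow from strict inclusion.)
HasButterfly : ∀ {n} → Family n → Set
HasButterfly {n} 𝒢 =
  Σ (Subset n) λ a → Σ (Subset n) λ b → Σ (Subset n) λ c → Σ (Subset n) λ d →
    𝒢 a × 𝒢 b × 𝒢 c × 𝒢 d × a ≢ b × c ≢ d ×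
    a ⊂ c × a ⊂ d × b ⊂ c × b ⊂ d

ButterflyFree : ∀ {n} → Family n → Set
ButterflyFree 𝒢 = ¬ HasButterfly 𝒢

Trace : ∀ {n} → List (Subset n) → Subset n → Family n
Trace ℱ L X = ∃ λ F → F ∈ ℱ × X ≡ F ∩ L

TraceButterflyFree : ∀ {n} → List (Subset n) → Set
TraceButterflyFree ℱ = ∀ L → ButterflyFree (Trace ℱ L)

-- The family F₀ = {∅, {1}, {2}, {1,2}, {3}, {4}, {3,4}, {5}} is
-- trace B-free.  Whether a given list is trace B-free is decidable for any n
-- (a butterfly in the trace on L is witnessed by four members of the list,
-- and there are finitely many L), so this is settled by evaluation.
--
-- If four members A, B, C, D of a trace B-free family are split
-- into bottoms a, b and tops c, d, then their traces on the "separator"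
-- L = [n] ∖ ((a ∪ b) ∖ (c ∩ d)) do not form a butterfly.  Calling a quadruple
-- obstructed when one of its six splits does form a butterfly there, a trace
-- B-free family contains no obstructed quadruple.  A generic branch-and-bound
-- search, proved sound once and for all for an arbitrary Boolean test on
-- quadruples, then certifies by evaluation that every duplicate-free
-- list of subsets of [5] without obstructed quadruples has length at most 8.
module Submission where

open import Defs
open import Data.Bool using (Bool; true; false; T; not; _∧_; _∨_)
import Data.Bool as Bool
open import Data.Bool.Properties using (T-∧; T-∨; T-≡)
open import Data.Empty using (⊥-elim)
open import Data.Nat using (ℕ; zero; suc; _+_; _≤_; _≤ᵇ_; z≤n; s≤s)
open import Data.Nat.Properties using (≤ᵇ⇒≤; ≤-trans; ≤-reflexive; +-suc; +-monoʳ-≤; module ≤-Reasoning)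
open import Data.Fin.Subset using (Subset; _∩_; _⊂_)
open import Data.Fin.Subset.Properties using (_⊂?_)
open import Data.Vec using ([]; _∷_)
open import Data.Vec.Properties using (≡-dec)
open import Data.List using (List; []; _∷_; length; filter; map; _++_)
open import Data.Bool.ListAction using (any)
open import Data.List.Properties using (filter-all)
open import Data.List.Relation.Unary.Any as Any using (Any; here; there; any?)
open import Data.List.Relation.Unary.Any.Properties using (any⁻)
open import Data.List.Relation.Unary.All as All using (All; []; _∷_; all?)
open import Data.List.Relation.Unary.AllPairs using (_∷_)
open import Data.List.Relation.Unary.Unique.Propositional using (Unique)
open import Data.List.Relation.Unary.Unique.Propositional.Properties using (filter⁺)
open import Data.List.Membership.Propositional using (_∈_; find; lose)
open import Data.List.Membership.Propositional.Properties
  using (∈-filter⁺; ∈-filter⁻; ∈-++⁺ˡ; ∈-++⁺ʳ; ∈-map⁺)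
open import Data.List.Relation.Binary.Subset.Propositional using (_⊆_)
open import Data.Product using (Σ; _×_; _,_; proj₁)
open import Data.Sum using (inj₁; inj₂)
open import Function using (Equivalence)
open import Relation.Binary.Definitions using (DecidableEquality)
open import Relation.Binary.PropositionalEquality using (_≡_; refl; sym; cong; _≢_)
open import Relation.Nullary using (¬_; Dec; does; yes; no; ¬?)
open import Relation.Nullary.Decidable using (_×-dec_; map′; T?)
open import Relation.Unary using (Decidable)

∈-tail : ∀ {A : Set} {x y : A} {ys} → x ∈ y ∷ ys → x ≢ y → x ∈ ys
∈-tail (here x≡y)   x≢y = ⊥-elim (x≢y x≡y)
∈-tail (there x∈ys) _   = x∈ys

module Counting {A : Set} (_≟_ : DecidableEquality A) where

  _without_ : List A → A → List A
  xs without x = filter (λ y → ¬? (y ≟ x)) xs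

  ∈-without⁻ : ∀ xs {x y} → y ∈ xs without x → y ∈ xs × y ≢ x
  ∈-without⁻ xs {x} = ∈-filter⁻ (λ y → ¬? (y ≟ x)) {xs = xs}

  length-without : ∀ {xs} → Unique xs → ∀ x → length xs ≤ suc (length (xs without x))
  length-without {[]}     _            x = z≤n
  length-without {y ∷ ys} (y∉ys ∷ u) x with y ≟ x
  ... | yes refl = s≤s (≤-reflexive (cong length (sym (filter-all (λ z → ¬? (z ≟ x)) x∉ys))))
    where x∉ys = All.map (λ x≢z z≡x → x≢z (sym z≡x)) y∉ys
  ... | no _     = s≤s (length-without u x)

  length-⊆ : ∀ {xs} ys → Unique xs → xs ⊆ ys → length xs ≤ length ys
  length-⊆ {[]}    []       _ _    = z≤n
  length-⊆ {_ ∷ _} []       _ xs⊆ with () ← xs⊆ (here refl)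
  length-⊆ {xs}    (y ∷ ys) u xs⊆ =
    ≤-trans (length-without u y)
            (s≤s (length-⊆ ys (filter⁺ _ u) (λ z∈ → let z∈xs , z≢y = ∈-without⁻ xs z∈
                                                      in  ∈-tail (xs⊆ z∈xs) z≢y)))

anyPair : ∀ {A : Set} → (A → A → Bool) → List A → Bool
anyPair f []       = false
anyPair f (p ∷ qs) = any (f p) qs ∨ anyPair f qs

anyPair-sound : ∀ {A : Set} (f : A → A → Bool) xs →
                T (anyPair f xs) → Any (λ p → Any (λ q → T (f p q)) xs) xs
anyPair-sound f (p ∷ qs) t with Equivalence.to T-∨ t
... | inj₁ fpq = here (there (any⁻ (f p) qs fpq))
... | inj₂ fqq = there (Any.map there (anyPair-sound f qs fqq))

T-does⇒ : ∀ {P : Set} (P? : Dec P) → T (does P?) → P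
T-does⇒ (yes p) _ = p

certified : ∀ {P : Set} (P? : Dec P) → does P? ≡ true → P
certified P? evaluates = T-does⇒ P? (Equivalence.from T-≡ evaluates)

subsets : (n : ℕ) → List (Subset n)
subsets zero    = [] ∷ []
subsets (suc n) = map (false ∷_) (subsets n) ++ map (true ∷_) (subsets n)

∈-subsets : ∀ {n} (s : Subset n) → s ∈ subsets n
∈-subsets []          = here refl
∈-subsets (false ∷ s) = ∈-++⁺ˡ (∈-map⁺ (false ∷_) (∈-subsets s))
∈-subsets {suc n} (true ∷ s) =
  ∈-++⁺ʳ (map (false ∷_) (subsets n)) (∈-map⁺ (true ∷_) (∈-subsets s))

module BranchAndBound {A : Set} (_≟_ : DecidableEquality A)
    (bad : A → A → A → A → Bool) (m : ℕ) where

  open Counting _≟_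
  open import Data.List.Membership.DecPropositional _≟_ using (_∈?_)

  BadFree : (A → Set) → Set
  BadFree M = ∀ {a b c d} → M a → M b → M c → M d → ¬ T (bad a b c d)

  -- Once x is added to `chosen`, y stays admissible: no p, q in `chosen`
  -- make (p, q, x, y) bad.
  Compatible : List A → A → A → Set
  Compatible chosen x y = ¬ T (anyPair (λ p q → bad p q x y) chosen)

  compatible? : ∀ chosen x → Decidable (Compatible chosen x)
  compatible? chosen x y = ¬? (T? (anyPair (λ p q → bad p q x y) chosen))

  fits : List A → List A → Bool
  fits chosen cands = length chosen + length cands ≤ᵇ m

  -- `search k chosen cands` succeeds only if every admissible extension of
  -- `chosen` by candidates has at most m elements: either `fits` holds, or
  -- both branches succeed -- taking the first candidate x (keeping only the
  -- candidates compatible with it) and skipping it.  The fuel k must exceed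
  -- length cands.
  search : ℕ → List A → List A → Bool
  search zero    chosen cands    = false
  search (suc k) chosen []       = fits chosen []
  search (suc k) chosen (x ∷ xs) =
    fits chosen (x ∷ xs) ∨
    (search k (x ∷ chosen) (filter (compatible? chosen x) xs) ∧ search k chosen xs)

  fits-sound : ∀ chosen cands → T (fits chosen cands) →
               ∀ {G} → Unique G → G ⊆ cands → length chosen + length G ≤ m
  fits-sound chosen cands fit uG G⊆ =
    ≤-trans (+-monoʳ-≤ (length chosen) (length-⊆ cands uG G⊆))
            (≤ᵇ⇒≤ (length chosen + length cands) m fit)

  module _ {M : A → Set} (badFree : BadFree M) where

    -- Inside M every candidate is compatible, so filtering loses nothing.
    compatible : ∀ {chosen x y} → All M chosen → M x → M y → Compatible chosen x y
    compatible {chosen} {x} {y} Mch Mx My pq =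
      let Mp , q = All.lookupAny Mch (anyPair-sound (λ p q → bad p q x y) chosen pq)
          Mq , pqxy = All.lookupAny Mch q
      in  badFree Mp Mq Mx My pqxy

    search-sound : ∀ k chosen cands → T (search k chosen cands) → All M chosen →
                   ∀ {G} → Unique G → All M G → G ⊆ cands → length chosen + length G ≤ m
    search-sound (suc k) chosen [] ok _ uG _ G⊆ = fits-sound chosen [] ok uG G⊆
    search-sound (suc k) chosen (x ∷ xs) ok Mch {G} uG MG G⊆
      with Equivalence.to T-∨ ok
    ... | inj₁ fit = fits-sound chosen (x ∷ xs) fit uG G⊆
    ... | inj₂ branches with Equivalence.to T-∧ branches | x ∈? G
    ... | _ , skip | no x∉G =
      search-sound k chosen xs skip Mch uG MG
        (λ y∈G → ∈-tail (G⊆ y∈G) (λ { refl → x∉G y∈G }))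
    ... | take , _ | yes x∈G = begin
        length chosen + length G              ≤⟨ +-monoʳ-≤ (length chosen) (length-without uG x) ⟩
        length chosen + suc (length G′)       ≡⟨ +-suc (length chosen) (length G′) ⟩
        length (x ∷ chosen) + length G′       ≤⟨ search-sound k (x ∷ chosen) _ take (Mx ∷ Mch)
                                                   (filter⁺ _ uG) MG′ G′⊆ ⟩
        m                                     ∎
      where
      open ≤-Reasoning
      G′ = G without x
      Mx = All.lookup MG x∈G
      MG′ : All M G′
      MG′ = All.tabulate (λ y∈ → All.lookup MG (proj₁ (∈-without⁻ G y∈)))
      G′⊆ : G′ ⊆ filter (compatible? chosen x) xs
      G′⊆ y∈ = let y∈G , y≢x = ∈-without⁻ G y∈
               in  ∈-filter⁺ (compatible? chosen x) (∈-tail (G⊆ y∈G) y≢x)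
                             (compatible Mch Mx (All.lookup MG y∈G))

    -- A search from scratch over a list of all elements bounds every
    -- duplicate-free list inside M.  Its success is taken as an equation,
    -- so that `refl` checks it by a single evaluation.
    search-bound : ∀ k univ → search k [] univ ≡ true → (∀ x → x ∈ univ) →
                   ∀ {G} → Unique G → All M G → length G ≤ m
    search-bound k univ ok complete uG MG =
      search-sound k [] univ (Equivalence.from T-≡ ok) [] uG MG (λ {y} _ → complete y)

_≟ₛ_ : ∀ {n} → DecidableEquality (Subset n)
_≟ₛ_ = ≡-dec Bool._≟_

IsButterfly : ∀ {n} → Subset n → Subset n → Subset n → Subset n → Set
IsButterfly a b c d = a ≢ b × c ≢ d × a ⊂ c × a ⊂ d × b ⊂ c × b ⊂ d

isButterfly? : ∀ {n} (a b c d : Subset n) → Dec (IsButterfly a b c d)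
isButterfly? a b c d =
  ¬? (a ≟ₛ b) ×-dec ¬? (c ≟ₛ d) ×-dec a ⊂? c ×-dec a ⊂? d ×-dec b ⊂? c ×-dec b ⊂? d

hasButterfly : ∀ {n} {𝒢 : Family n} {a b c d} →
               𝒢 a → 𝒢 b → 𝒢 c → 𝒢 d → IsButterfly a b c d → HasButterfly 𝒢
hasButterfly 𝒢a 𝒢b 𝒢c 𝒢d (a≢b , c≢d , a⊂c , a⊂d , b⊂c , b⊂d) =
  _ , _ , _ , _ , 𝒢a , 𝒢b , 𝒢c , 𝒢d , a≢b , c≢d , a⊂c , a⊂d , b⊂c , b⊂d

ButterflyInTrace : ∀ {n} → List (Subset n) → Subset n → Set
ButterflyInTrace ℱ L =
  Any (λ A → Any (λ B → Any (λ C → Any (λ D →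
    IsButterfly (A ∩ L) (B ∩ L) (C ∩ L) (D ∩ L)) ℱ) ℱ) ℱ) ℱ

butterflyInTrace? : ∀ {n} (ℱ : List (Subset n)) L → Dec (ButterflyInTrace ℱ L)
butterflyInTrace? ℱ L =
  any? (λ A → any? (λ B → any? (λ C → any? (λ D →
    isButterfly? (A ∩ L) (B ∩ L) (C ∩ L) (D ∩ L)) ℱ) ℱ) ℱ) ℱ

butterflyInTrace⇒ : ∀ {n} {ℱ : List (Subset n)} {L} →
                    ButterflyInTrace ℱ L → HasButterfly (Trace ℱ L)
butterflyInTrace⇒ t =
  let A , A∈ℱ , t₁ = find t
      B , B∈ℱ , t₂ = find t₁
      C , C∈ℱ , t₃ = find t₂
      D , D∈ℱ , butterfly = find t₃
  in  hasButterfly (A , A∈ℱ , refl) (B , B∈ℱ , refl) (C , C∈ℱ , refl) (D , D∈ℱ , refl)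
                   butterfly

butterflyInTrace⇐ : ∀ {n} {ℱ : List (Subset n)} {L} →
                    HasButterfly (Trace ℱ L) → ButterflyInTrace ℱ L
butterflyInTrace⇐ (_ , _ , _ , _ , (A , A∈ℱ , refl) , (B , B∈ℱ , refl) ,
                   (C , C∈ℱ , refl) , (D , D∈ℱ , refl) , butterfly) =
  lose A∈ℱ (lose B∈ℱ (lose C∈ℱ (lose D∈ℱ butterfly)))

traceButterflyFree? : ∀ {n} (ℱ : List (Subset n)) → Dec (TraceButterflyFree ℱ)
traceButterflyFree? {n} ℱ =
  map′ (λ none L hb → All.lookup none (∈-subsets L) (butterflyInTrace⇐ hb))
       (λ free → All.tabulate (λ {L} _ t → free L (butterflyInTrace⇒ t)))
       (all? (λ L → ¬? (butterflyInTrace? ℱ L)) (subsets n))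

-- On it the traces of a and b lie
-- inside those of c and d, which is why this L is the one worth testing
-- (soundness holds for any L).
separator : ∀ {n} (a b c d : Subset n) → Subset n
separator []      []      []      []      = []
separator (a ∷ as) (b ∷ bs) (c ∷ cs) (d ∷ ds) =
  not ((a ∨ b) ∧ not (c ∧ d)) ∷ separator as bs cs ds

-- Two bottoms followed by two tops.
Quadruple : ℕ → Set
Quadruple n = Subset n × Subset n × Subset n × Subset n

Separated : ∀ {n} → Quadruple n → Set
Separated (a , b , c , d) = IsButterfly (a ∩ L) (b ∩ L) (c ∩ L) (d ∩ L)
  where L = separator a b c d

separated? : ∀ {n} (q : Quadruple n) → Dec (Separated q)
separated? (a , b , c , d) = isButterfly? (a ∩ L) (b ∩ L) (c ∩ L) (d ∩ L)
  where L = separator a b c d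

splits : ∀ {n} (A B C D : Subset n) → List (Quadruple n)
splits A B C D = (A , B , C , D) ∷ (A , C , B , D) ∷ (A , D , B , C) ∷
                 (B , C , A , D) ∷ (B , D , A , C) ∷ (C , D , A , B) ∷ []

Obstructed : ∀ {n} (A B C D : Subset n) → Set
Obstructed A B C D = Any Separated (splits A B C D)

obstructed? : ∀ {n} (A B C D : Subset n) → Dec (Obstructed A B C D)
obstructed? A B C D = any? separated? (splits A B C D)

obstructed : ∀ {n} (A B C D : Subset n) → Bool
obstructed A B C D = does (obstructed? A B C D)

InFamily : ∀ {n} → List (Subset n) → Quadruple n → Set
InFamily ℱ (a , b , c , d) = a ∈ ℱ × b ∈ ℱ × c ∈ ℱ × d ∈ ℱ

obstruction-free : ∀ {n} {ℱ : List (Subset n)} → TraceButterflyFree ℱ →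
                   ∀ {A B C D} → A ∈ ℱ → B ∈ ℱ → C ∈ ℱ → D ∈ ℱ → ¬ T (obstructed A B C D)
obstruction-free {ℱ = ℱ} free {A} {B} {C} {D} A∈ B∈ C∈ D∈ ob =
  let (a∈ , b∈ , c∈ , d∈) , separated =
        All.lookupAny members (T-does⇒ (obstructed? A B C D) ob)
  in  free _ (butterflyInTrace⇒ (lose a∈ (lose b∈ (lose c∈ (lose d∈ separated)))))
  where
  members : All (InFamily ℱ) (splits A B C D)
  members = (A∈ , B∈ , C∈ , D∈) ∷ (A∈ , C∈ , B∈ , D∈) ∷ (A∈ , D∈ , B∈ , C∈) ∷
            (B∈ , C∈ , A∈ , D∈) ∷ (B∈ , D∈ , A∈ , C∈) ∷ (C∈ , D∈ , A∈ , B∈) ∷ []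

F₀ : List (Subset 5)
F₀ = (false ∷ false ∷ false ∷ false ∷ false ∷ []) ∷
     (true  ∷ false ∷ false ∷ false ∷ false ∷ []) ∷
     (false ∷ true  ∷ false ∷ false ∷ false ∷ []) ∷
     (true  ∷ true  ∷ false ∷ false ∷ false ∷ []) ∷
     (false ∷ false ∷ true  ∷ false ∷ false ∷ []) ∷
     (false ∷ false ∷ false ∷ true  ∷ false ∷ []) ∷
     (false ∷ false ∷ true  ∷ true  ∷ false ∷ []) ∷
     (false ∷ false ∷ false ∷ false ∷ true  ∷ []) ∷ []

open BranchAndBound (_≟ₛ_ {5}) obstructed 8 using (search-bound)

lemma2p4 : (Σ (List (Subset 5)) λ ℱ → Unique ℱ × TraceButterflyFree ℱ × length ℱ ≡ 8)
           × ((ℱ : List (Subset 5)) → Unique ℱ → TraceButterflyFree ℱ → length ℱ ≤ 8)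
lemma2p4 =
  (F₀ , certified (unique? F₀) refl , certified (traceButterflyFree? F₀) refl , refl) ,
  -- ℱ avoids obstructed quadruples; the search over all 32 subsets (fuel 33)
  -- succeeds, by evaluation, so |ℱ| ≤ 8.
  λ ℱ unique free →
    search-bound (obstruction-free free) 33 (subsets 5) refl ∈-subsets
                 unique (All.tabulate (λ F∈ℱ → F∈ℱ))
  where open import Data.List.Relation.Unary.Unique.DecPropositional _≟ₛ_ using (unique?)
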